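{- Let $d\ge 3$, $2\le \ell\le d$, $2\le a\le d$, and $1\le m\le\lfloor a/2\rfloor$. Let $P:=T_m^{d,d-a}$ be a $d$-polytope with at least $d+\ell$ facets, and suppose $P$ is not (combinatorially equivalent to) $T_1^{d,d-\ell}$. Then: (i) if $m=1$, then $f_k(P)>f_k(T_1^{d,d-\ell})$ for each $k\ge \ell-1$; (ii) if $m\ge 2$, then $f_k(P)>f_k(T_1^{d,d-\ell})$ for each $k\in\{1,\dots,d-2\}$.
   Context: $f_k(Q)$ denotes the number of $k$-faces of a polytope $Q$ (for a $d$-polytope, $0\le k\le d-1$). $T(j)$ is a $j$-simplex. For polytopes $Q\subset\mathbb{R}^p$, $Q'\subset\mathbb{R}^q$ with the origin in their relative interiors, $Q\oplus Q'$ is the convex hull of $\{(x,0):x\in Q\}\cup\{(0,y):y\in Q'\}$. $T_m^{d,d-a}$ denotes the $(d-a)$-fold pyramid over $T(m)\oplus T(a-m)$; it is a $d$-polytope with $d+2$ vertices and $d+1+m(a-m)$ facets. -}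

module Defs where

open import Data.Nat using (ℕ; zero; suc; _+_; _∸_; _<ᵇ_; _≡ᵇ_)
open import Data.Bool using (Bool; true; false; _∧_; _∨_; not)
open import Data.Fin using (Fin; toℕ)
open import Data.Fin.Subset using (Subset; ∣_∣)
open import Data.Vec using (Vec; []; _∷_; lookup; tabulate)
open import Data.List using (List; []; _∷_; _++_; map; filter; length; allFin)
open import Data.List.Base using (all)
open import Data.Product using (Σ)
open import Function.Bundles using (_↔_; Inverse)
open import Relation.Binary.PropositionalEquality using (_≡_)
open import Relation.Nullary.Decidable using (T?)
open import Data.Bool using (T)

-- Combinatorial model of T_m^{d,d-a} = (d-a)-fold pyramid over T(m) ⊕ T(a-m).
-- Its d+2 vertices are indexed by Fin (2 + d):
--   indices 0 .. m          : the m+1 vertices of T(m)        (part A)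
--   indices m+1 .. a+1      : the a-m+1 vertices of T(a-m)    (part B)
--   indices a+2 .. d+1      : the d-a pyramid apexes          (part C)
data Part : Set where
  A B C : Part

_==P_ : Part → Part → Bool
A ==P A = true
B ==P B = true
C ==P C = true
_ ==P _ = false

part : (d a m : ℕ) → Fin (2 + d) → Part
part d a m i with toℕ i <ᵇ suc m | toℕ i <ᵇ (a + 2)
... | true  | _     = A
... | false | true  = B
... | false | false = C

covers : (d a m : ℕ) → Part → Subset (2 + d) → Bool
covers d a m p S = all (λ i → not (part d a m i ==P p) ∨ lookup S i) (allFin (2 + d))

-- Faces of T(m) ⊕ T(a-m): ∅, the whole polytope, and joins S_A ∪ S_B of proper
-- faces S_A ⊊ A, S_B ⊊ B (not both empty).  Faces of the iterated pyramid:
-- a face of the base (incl. ∅ and the base) joined with any set of apexes.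
isFace : (d a m : ℕ) → Subset (2 + d) → Bool
isFace d a m S =
  (not (covers d a m A S) ∧ not (covers d a m B S)) ∨ (covers d a m A S ∧ covers d a m B S)

-- dimension of a nonempty face: faces not containing A ∪ B are simplices
-- (dim = |S| - 1); faces containing A ∪ B are pyramids over T(m) ⊕ T(a-m)
-- (dim = a + |S ∩ C| = |S| - 2).
faceDim : (d a m : ℕ) → Subset (2 + d) → ℕ
faceDim d a m S with covers d a m A S ∧ covers d a m B S
... | true  = ∣ S ∣ ∸ 2
... | false = ∣ S ∣ ∸ 1

allSubsets : (n : ℕ) → List (Subset n)
allSubsets zero = [] ∷ []
allSubsets (suc n) = map (true ∷_) (allSubsets n) ++ map (false ∷_) (allSubsets n)

fk : (d a m : ℕ) → ℕ → ℕ
fk d a m k = length (filter (λ S → T? (isFace d a m S ∧ (0 <ᵇ ∣ S ∣) ∧ (faceDim d a m S ≡ᵇ k)))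
                           (allSubsets (2 + d)))

image : {n : ℕ} → Fin n ↔ Fin n → Subset n → Subset n
image σ S = tabulate (λ j → lookup S (Inverse.from σ j))

CombEquiv : (d a m a' m' : ℕ) → Set
CombEquiv d a m a' m' =
  Σ (Fin (2 + d) ↔ Fin (2 + d)) (λ σ → ∀ S → isFace d a m S ≡ isFace d a' m' (image σ S))

-- Count faces by their complements.  With j = d - k ≥ 0 and k ≥ 1, a nonempty vertex set S
-- of T_m^{d,d-a} is a k-face iff either S misses a vertex of each of the simplices A = T(m) and
-- B = T(a-m) and has j + 1 non-vertices, or S ⊇ A ∪ B and S has j non-vertices.  Inclusion-
-- exclusion over the events S ⊇ A, S ⊇ B gives, with H t = C(d+1-t, j+1),
--     f_k(T_m^{d,d-a}) + H m + H (a-m) = C(d+2, j+1) + H a.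
-- Hence f_k(T_1^{d,d-ℓ}) < f_k(T_m^{d,d-a}) iff H m + H (a-m) + H ℓ < H 1 + H (ℓ-1) + H a.
-- The differences δ t = H t - H (t+1) = C(d-t, j) and ε t = δ t - δ (t+1) = C(d-1-t, j-1)
-- are antitone, so H is discretely convex.  For k = d-1 the identity gives
-- f_{d-1} = d + 1 + m(a-m), so the facet hypothesis says ℓ - 1 ≤ m(a-m).  For m = 1 the
-- inequality is δ (a-1) < δ (ℓ-1), i.e. ℓ < a (ℓ = a is the excluded T_1^{d,d-ℓ}); for m ≥ 2,
-- convexity gives H m + H b < H 1 + δ (m b) + H (m+b) with b = a-m, and δ (m b) ≤ δ (ℓ-1).

module Submission where

open import Defs
open import Data.Nat using (ℕ; _+_; _∸_; _≤_; _<_; ⌊_/2⌋)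
open import Data.Product using (_×_)
open import Relation.Nullary using (¬_)
open import Relation.Binary.PropositionalEquality using (_≡_)

open import Data.Bool using (Bool; true; false; T; _∧_; _∨_; not; if_then_else_)
open import Data.Bool.Properties using (∧-assoc; ∧-zeroʳ)
open import Data.Empty using (⊥-elim)
open import Data.Fin using (Fin; zero; suc; toℕ)
open import Data.Fin.Subset using (Subset; ∣_∣; ∁; ⊥; _∪_)
open import Data.Fin.Subset.Properties using (∣∁p∣≡n∸∣p∣; ∣p∣≤n; ∣⊥∣≡0)
import Data.List as List
open import Data.List using (List; []; _∷_; map; filter; length)
open import Data.List.Properties using (map-++; map-∘; map-cong; map-tabulate)
open import Data.Nat using (zero; suc; _*_; ⌈_/2⌉; _<ᵇ_; _≡ᵇ_; z≤n; s≤s; _≤′_; ≤′-refl; ≤′-step)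
open import Data.Nat.Combinatorics using (nCk+nC[k+1]≡[n+1]C[k+1]; nC1≡n)
  renaming (_C_ to _choose_)
open import Data.Nat.ListAction using (sum)
open import Data.Nat.ListAction.Properties using (sum-++)
open import Data.Nat.Properties
open import Data.Nat.Tactic.RingSolver using (solve-∀)
open import Data.Product using (∃-syntax; _,_)
open import Data.Sum using (inj₁; inj₂)
open import Data.Unit using (tt)
open import Data.Vec using ([]; _∷_; lookup; tabulate)
open import Data.Vec.Properties using (tabulate-cong; tabulate∘lookup)
open import Function using (_∘_; id)
open import Function.Construct.Identity using (↔-id)
open import Relation.Binary.PropositionalEquality
  using (refl; sym; trans; cong; cong₂; subst; subst₂; module ≡-Reasoning)
open import Relation.Nullary.Decidable using (T?)

open import Algebra.Properties.CommutativeSemigroup +-commutativeSemigroup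
  using (interchange; xy∙z≈y∙xz; xy∙z≈xz∙y; x∙yz≈xz∙y; x∙yz≈zx∙y)

𝟙 : Bool → ℕ
𝟙 true  = 1
𝟙 false = 0

T-injective : ∀ {b c} → (T b → T c) → (T c → T b) → b ≡ c
T-injective {true}  {true}  _ _ = refl
T-injective {true}  {false} f _ = ⊥-elim (f tt)
T-injective {false} {true}  _ g = ⊥-elim (g tt)
T-injective {false} {false} _ _ = refl

≡ᵇ-cancel : ∀ x y u w → x + y ≡ u + w → (x ≡ᵇ u) ≡ (y ≡ᵇ w)
≡ᵇ-cancel x y u w e = T-injective
  (λ x≡u → ≡⇒≡ᵇ y w (+-cancelˡ-≡ x y w (trans e (cong (_+ w) (sym (≡ᵇ⇒≡ x u x≡u))))))
  (λ y≡w → ≡⇒≡ᵇ x u (+-cancelʳ-≡ y x u (trans e (cong (u +_) (sym (≡ᵇ⇒≡ y w y≡w))))))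

0<s∧s∸1≡ᵇ1+k : ∀ s k → (0 <ᵇ s) ∧ (s ∸ 1 ≡ᵇ suc k) ≡ (s ≡ᵇ 2 + k)
0<s∧s∸1≡ᵇ1+k zero    k = refl
0<s∧s∸1≡ᵇ1+k (suc s) k = refl

0<s∧s∸2≡ᵇ1+k : ∀ s k → (0 <ᵇ s) ∧ (s ∸ 2 ≡ᵇ suc k) ≡ (s ≡ᵇ 3 + k)
0<s∧s∸2≡ᵇ1+k zero          k = refl
0<s∧s∸2≡ᵇ1+k (suc zero)    k = refl
0<s∧s∸2≡ᵇ1+k (suc (suc s)) k = refl

<-by-offsets : ∀ {x y z p q r s} → x + p ≡ z + r → y + q ≡ z + s → q + r < p + s → x < y
<-by-offsets {x} {y} {z} {p} {q} {r} {s} x+p≡z+r y+q≡z+s q+r<p+s = +-cancelʳ-< (p + s) x y (begin-strict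
    x + (p + s)   ≡⟨ +-assoc x p s ⟨
    x + p + s     ≡⟨ cong (_+ s) x+p≡z+r ⟩
    z + r + s     ≡⟨ xy∙z≈xz∙y z r s ⟩
    z + s + r     ≡⟨ cong (_+ r) y+q≡z+s ⟨
    y + q + r     ≡⟨ +-assoc y q r ⟩
    y + (q + r)   <⟨ +-monoʳ-< y q+r<p+s ⟩
    y + (p + s)   ∎)
  where open ≤-Reasoning

≤⇒offset : ∀ {k d} n → k + n ≤ d → ∃[ i ] k + (n + i) ≡ d
≤⇒offset {k} n k+n≤d with i , k+n+i≡d ← m≤n⇒∃[o]m+o≡n k+n≤d = i , trans (sym (+-assoc k n i)) k+n+i≡d

m≤⌊n/2⌋⇒m+m≤n : ∀ {m n} → m ≤ ⌊ n /2⌋ → m + m ≤ n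
m≤⌊n/2⌋⇒m+m≤n {m} {n} m≤n/2 = begin
  m + m                 ≤⟨ +-mono-≤ m≤n/2 (≤-trans m≤n/2 (⌊n/2⌋≤⌈n/2⌉ n)) ⟩
  ⌊ n /2⌋ + ⌈ n /2⌉     ≡⟨ ⌊n/2⌋+⌈n/2⌉≡n n ⟩
  n                     ∎
  where open ≤-Reasoning

-- Counting subsets of a finite set
∑ : (n : ℕ) → (Subset n → ℕ) → ℕ
∑ n f = sum (map f (allSubsets n))

length-filter≡sum : ∀ {A : Set} (p : A → Bool) (xs : List A) →
                    length (filter (λ x → T? (p x)) xs) ≡ sum (map (𝟙 ∘ p) xs)
length-filter≡sum p []       = refl
length-filter≡sum p (x ∷ xs) with p x
... | true  = cong suc (length-filter≡sum p xs)
... | false = length-filter≡sum p xs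

sum-map-+ : ∀ {A : Set} (f g : A → ℕ) (xs : List A) →
            sum (map (λ x → f x + g x) xs) ≡ sum (map f xs) + sum (map g xs)
sum-map-+ f g []       = refl
sum-map-+ f g (x ∷ xs) = trans (cong (f x + g x +_) (sum-map-+ f g xs))
                               (interchange (f x) (g x) _ _)

∑-suc : ∀ n (f : Subset (suc n) → ℕ) → ∑ (suc n) f ≡ ∑ n (f ∘ (true ∷_)) + ∑ n (f ∘ (false ∷_))
∑-suc n f = begin
    sum (map f (map (true ∷_) Ss List.++ map (false ∷_) Ss))
  ≡⟨ cong sum (map-++ f (map (true ∷_) Ss) _) ⟩
    sum (map f (map (true ∷_) Ss) List.++ map f (map (false ∷_) Ss))
  ≡⟨ sum-++ (map f (map (true ∷_) Ss)) _ ⟩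
    sum (map f (map (true ∷_) Ss)) + sum (map f (map (false ∷_) Ss))
  ≡⟨ sym (cong₂ _+_ (cong sum (map-∘ Ss)) (cong sum (map-∘ Ss))) ⟩
    ∑ n (f ∘ (true ∷_)) + ∑ n (f ∘ (false ∷_)) ∎
  where
  open ≡-Reasoning
  Ss = allSubsets n

∑-cong : ∀ n {f g : Subset n → ℕ} → (∀ S → f S ≡ g S) → ∑ n f ≡ ∑ n g
∑-cong n f≗g = cong sum (map-cong f≗g (allSubsets n))

∑-+ : ∀ n (f g : Subset n → ℕ) → ∑ n (λ S → f S + g S) ≡ ∑ n f + ∑ n g
∑-+ n f g = sum-map-+ f g (allSubsets n)

∑-+₃ : ∀ n (f g h : Subset n → ℕ) →
       ∑ n (λ S → f S + (g S + h S)) ≡ ∑ n f + (∑ n g + ∑ n h)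
∑-+₃ n f g h = trans (∑-+ n f _) (cong (∑ n f +_) (∑-+ n g h))

∑-zero : ∀ n → ∑ n (λ _ → 0) ≡ 0
∑-zero zero    = refl
∑-zero (suc n) = trans (∑-suc n _) (cong₂ _+_ (∑-zero n) (∑-zero n))

infix 5 _⊆ᵇ_
_⊆ᵇ_ : ∀ {n} → Subset n → Subset n → Bool
[]      ⊆ᵇ []      = true
(x ∷ p) ⊆ᵇ (y ∷ q) = (not x ∨ y) ∧ (p ⊆ᵇ q)

⊥⊆ᵇ : ∀ {n} (p : Subset n) → ⊥ ⊆ᵇ p ≡ true
⊥⊆ᵇ []      = refl
⊥⊆ᵇ (_ ∷ p) = ⊥⊆ᵇ p

⊆ᵇ-∪ : ∀ {n} (p q r : Subset n) → (p ⊆ᵇ r) ∧ (q ⊆ᵇ r) ≡ (p ∪ q) ⊆ᵇ r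
⊆ᵇ-∪ []          []          []          = refl
⊆ᵇ-∪ (false ∷ p) (false ∷ q) (_     ∷ r) = ⊆ᵇ-∪ p q r
⊆ᵇ-∪ (true  ∷ p) (false ∷ q) (z     ∷ r) = trans (∧-assoc z _ _) (cong (z ∧_) (⊆ᵇ-∪ p q r))
⊆ᵇ-∪ (false ∷ p) (true  ∷ q) (true  ∷ r) = ⊆ᵇ-∪ p q r
⊆ᵇ-∪ (false ∷ p) (true  ∷ q) (false ∷ r) = ∧-zeroʳ (p ⊆ᵇ r)
⊆ᵇ-∪ (true  ∷ p) (true  ∷ q) (true  ∷ r) = ⊆ᵇ-∪ p q r
⊆ᵇ-∪ (true  ∷ p) (true  ∷ q) (false ∷ r) = refl

and-allFin≡⊆ᵇ : ∀ {n} (f : Fin n → Bool) (p : Subset n) →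
                List.foldr _∧_ true (map (λ i → not (f i) ∨ lookup p i) (List.allFin n)) ≡ tabulate f ⊆ᵇ p
and-allFin≡⊆ᵇ {zero}  f []      = refl
and-allFin≡⊆ᵇ {suc n} f (x ∷ p) = cong ((not (f zero) ∨ x) ∧_) (trans
  (cong (List.foldr _∧_ true) (trans (map-tabulate suc g) (sym (map-tabulate id (g ∘ suc)))))
  (and-allFin≡⊆ᵇ (f ∘ suc) p))
  where
  g : Fin (suc n) → Bool
  g i = not (f i) ∨ lookup (x ∷ p) i

∪-tabulate : ∀ {n} (f g : Fin n → Bool) → tabulate f ∪ tabulate g ≡ tabulate (λ i → f i ∨ g i)
∪-tabulate {zero}  f g = refl
∪-tabulate {suc n} f g = cong ((f zero ∨ g zero) ∷_) (∪-tabulate (f ∘ suc) (g ∘ suc))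

∣p∣+∣∁p∣≡n : ∀ {n} (p : Subset n) → ∣ p ∣ + ∣ ∁ p ∣ ≡ n
∣p∣+∣∁p∣≡n p = trans (cong (∣ p ∣ +_) (∣∁p∣≡n∸∣p∣ p)) (m+[n∸m]≡n (∣p∣≤n p))

#supersets : ∀ {n} (p : Subset n) j →
             ∑ n (λ q → 𝟙 ((p ⊆ᵇ q) ∧ (∣ ∁ q ∣ ≡ᵇ j))) ≡ (n ∸ ∣ p ∣) choose j
#supersets []          zero    = refl
#supersets []          (suc j) = refl
#supersets {suc n} (true ∷ p) j = begin
    ∑ (suc n) _
  ≡⟨ ∑-suc n _ ⟩
    ∑ n (λ q → 𝟙 ((p ⊆ᵇ q) ∧ (∣ ∁ q ∣ ≡ᵇ j))) + ∑ n (λ _ → 0)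
  ≡⟨ cong₂ _+_ (#supersets p j) (∑-zero n) ⟩
    (n ∸ ∣ p ∣) choose j + 0
  ≡⟨ +-identityʳ _ ⟩
    (n ∸ ∣ p ∣) choose j ∎
  where open ≡-Reasoning
#supersets {suc n} (false ∷ p) zero = begin
    ∑ (suc n) _
  ≡⟨ ∑-suc n _ ⟩
    ∑ n (λ q → 𝟙 ((p ⊆ᵇ q) ∧ (∣ ∁ q ∣ ≡ᵇ 0))) + ∑ n (λ q → 𝟙 ((p ⊆ᵇ q) ∧ false))
  ≡⟨ cong₂ _+_ (#supersets p 0) (trans (∑-cong n (λ q → cong 𝟙 (∧-zeroʳ (p ⊆ᵇ q)))) (∑-zero n)) ⟩
    1 ∎
  where open ≡-Reasoning
#supersets {suc n} (false ∷ p) (suc j) = begin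
    ∑ (suc n) _
  ≡⟨ ∑-suc n _ ⟩
    ∑ n (λ q → 𝟙 ((p ⊆ᵇ q) ∧ (∣ ∁ q ∣ ≡ᵇ suc j))) + ∑ n (λ q → 𝟙 ((p ⊆ᵇ q) ∧ (∣ ∁ q ∣ ≡ᵇ j)))
  ≡⟨ cong₂ _+_ (#supersets p (suc j)) (#supersets p j) ⟩
    (n ∸ ∣ p ∣) choose suc j + (n ∸ ∣ p ∣) choose j
  ≡⟨ +-comm ((n ∸ ∣ p ∣) choose suc j) _ ⟩
    (n ∸ ∣ p ∣) choose j + (n ∸ ∣ p ∣) choose suc j
  ≡⟨ nCk+nC[k+1]≡[n+1]C[k+1] (n ∸ ∣ p ∣) j ⟩
    suc (n ∸ ∣ p ∣) choose suc j
  ≡⟨ cong (_choose suc j) (sym (+-∸-assoc 1 (∣p∣≤n p))) ⟩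
    (suc n ∸ ∣ p ∣) choose suc j ∎
  where open ≡-Reasoning

#supersets-of : ∀ {n} {P : Subset n → Bool} (p : Subset n) {s} →
                (∀ q → P q ≡ p ⊆ᵇ q) → ∣ p ∣ ≡ s → ∀ j →
                ∑ n (λ q → 𝟙 (P q ∧ (∣ ∁ q ∣ ≡ᵇ j))) ≡ (n ∸ s) choose j
#supersets-of {n} {P} p {s} P≡ ∣p∣≡s j = begin
    ∑ n (λ q → 𝟙 (P q ∧ (∣ ∁ q ∣ ≡ᵇ j)))
  ≡⟨ ∑-cong n (λ q → cong (λ c → 𝟙 (c ∧ (∣ ∁ q ∣ ≡ᵇ j))) (P≡ q)) ⟩
    ∑ n (λ q → 𝟙 ((p ⊆ᵇ q) ∧ (∣ ∁ q ∣ ≡ᵇ j)))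
  ≡⟨ #supersets p j ⟩
    (n ∸ ∣ p ∣) choose j
  ≡⟨ cong (λ t → (n ∸ t) choose j) ∣p∣≡s ⟩
    (n ∸ s) choose j ∎
  where open ≡-Reasoning

-- Faces of T_m^{d,d-a}
interval : (n p q : ℕ) → Subset n
interval n p q = tabulate (λ i → not (toℕ i <ᵇ p) ∧ (toℕ i <ᵇ q))

∣interval∣ : ∀ {n} p q → p ≤ q → q ≤ n → ∣ interval n p q ∣ ≡ q ∸ p
∣interval∣ {zero}  zero    zero    _         _         = refl
∣interval∣ {suc n} zero    zero    _         _         = ∣interval∣ {n} 0 0 z≤n z≤n
∣interval∣ {suc n} zero    (suc q) _         (s≤s q≤n) = cong suc (∣interval∣ 0 q z≤n q≤n)
∣interval∣ {suc n} (suc p) (suc q) (s≤s p≤q) (s≤s q≤n) = ∣interval∣ p q p≤q q≤n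

𝟙-inclusion-exclusion : ∀ cA cB e₀ e₁ →
  𝟙 (((not cA ∧ not cB) ∨ (cA ∧ cB)) ∧ (if cA ∧ cB then e₀ else e₁)) + (𝟙 (cA ∧ e₁) + 𝟙 (cB ∧ e₁))
    ≡ 𝟙 e₁ + (𝟙 ((cA ∧ cB) ∧ e₁) + 𝟙 ((cA ∧ cB) ∧ e₀))
𝟙-inclusion-exclusion false false e₀ e₁ = refl
𝟙-inclusion-exclusion true  false e₀ e₁ = refl
𝟙-inclusion-exclusion false true  e₀ e₁ = sym (+-identityʳ (𝟙 e₁))
𝟙-inclusion-exclusion true  true  e₀ e₁ = trans (+-comm (𝟙 e₀) _) (+-assoc (𝟙 e₁) _ _)

module _ (d a m : ℕ) where

  part≡A : ∀ i → (part d a m i ==P A) ≡ (toℕ i <ᵇ suc m)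
  part≡A i with toℕ i <ᵇ suc m | toℕ i <ᵇ (a + 2)
  ... | true  | _     = refl
  ... | false | true  = refl
  ... | false | false = refl

  part≡B : ∀ i → (part d a m i ==P B) ≡ not (toℕ i <ᵇ suc m) ∧ (toℕ i <ᵇ (a + 2))
  part≡B i with toℕ i <ᵇ suc m | toℕ i <ᵇ (a + 2)
  ... | true  | _     = refl
  ... | false | true  = refl
  ... | false | false = refl

  part∈A∪B : m ≤ a → ∀ i → (part d a m i ==P A) ∨ (part d a m i ==P B) ≡ (toℕ i <ᵇ (a + 2))
  part∈A∪B m≤a i with toℕ i <ᵇ suc m in i≤m | toℕ i <ᵇ (a + 2) in i≮a+2
  ... | true  | true  = refl
  ... | false | true  = refl
  ... | false | false = refl
  ... | true  | false = ⊥-elim (subst T i≮a+2 (<⇒<ᵇ (begin-strict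
        toℕ i <⟨ <ᵇ⇒< (toℕ i) (suc m) (subst T (sym i≤m) tt) ⟩
        suc m ≤⟨ s≤s m≤a ⟩
        suc a ≤⟨ n≤1+n (suc a) ⟩
        2 + a ≡⟨ +-comm 2 a ⟩
        a + 2 ∎)))
    where open ≤-Reasoning

  partSet : Part → Subset (2 + d)
  partSet p = tabulate (λ i → part d a m i ==P p)

  covers≡⊆ᵇ : ∀ p S → covers d a m p S ≡ partSet p ⊆ᵇ S
  covers≡⊆ᵇ p S = and-allFin≡⊆ᵇ (λ i → part d a m i ==P p) S

  covers-A : ∀ S → covers d a m A S ≡ interval (2 + d) 0 (suc m) ⊆ᵇ S
  covers-A S = trans (covers≡⊆ᵇ A S) (cong (_⊆ᵇ S) (tabulate-cong part≡A))

  covers-B : ∀ S → covers d a m B S ≡ interval (2 + d) (suc m) (a + 2) ⊆ᵇ S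
  covers-B S = trans (covers≡⊆ᵇ B S) (cong (_⊆ᵇ S) (tabulate-cong part≡B))

  covers-A∧B : m ≤ a → ∀ S → covers d a m A S ∧ covers d a m B S ≡ interval (2 + d) 0 (a + 2) ⊆ᵇ S
  covers-A∧B m≤a S = begin
      covers d a m A S ∧ covers d a m B S
    ≡⟨ cong₂ _∧_ (covers≡⊆ᵇ A S) (covers≡⊆ᵇ B S) ⟩
      (partSet A ⊆ᵇ S) ∧ (partSet B ⊆ᵇ S)
    ≡⟨ ⊆ᵇ-∪ (partSet A) (partSet B) S ⟩
      partSet A ∪ partSet B ⊆ᵇ S
    ≡⟨ cong (_⊆ᵇ S) (trans (∪-tabulate (λ i → part d a m i ==P A) (λ i → part d a m i ==P B)) (tabulate-cong (part∈A∪B m≤a))) ⟩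
      interval (2 + d) 0 (a + 2) ⊆ᵇ S ∎
    where open ≡-Reasoning

  faceDim≡ᵇ-by-complement : ∀ {k j} → suc k + j ≡ d → ∀ S →
    (0 <ᵇ ∣ S ∣) ∧ (faceDim d a m S ≡ᵇ suc k)
      ≡ (if covers d a m A S ∧ covers d a m B S then ∣ ∁ S ∣ ≡ᵇ j else ∣ ∁ S ∣ ≡ᵇ suc j)
  faceDim≡ᵇ-by-complement {k} {j} k+j≡d S with covers d a m A S ∧ covers d a m B S
  ... | true  = trans (0<s∧s∸2≡ᵇ1+k ∣ S ∣ k) (≡ᵇ-cancel ∣ S ∣ ∣ ∁ S ∣ (3 + k) j
                  (trans (∣p∣+∣∁p∣≡n S) (cong (2 +_) (sym k+j≡d))))
  ... | false = trans (0<s∧s∸1≡ᵇ1+k ∣ S ∣ k) (≡ᵇ-cancel ∣ S ∣ ∣ ∁ S ∣ (2 + k) (suc j)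
                  (trans (∣p∣+∣∁p∣≡n S) (cong (2 +_) (trans (sym k+j≡d) (sym (+-suc k j))))))

  k-face-inclusion-exclusion : ∀ {k j} → suc k + j ≡ d → ∀ S →
    let cA = covers d a m A S; cB = covers d a m B S; z = ∣ ∁ S ∣ in
    𝟙 (isFace d a m S ∧ (0 <ᵇ ∣ S ∣) ∧ (faceDim d a m S ≡ᵇ suc k))
      + (𝟙 (cA ∧ (z ≡ᵇ suc j)) + 𝟙 (cB ∧ (z ≡ᵇ suc j)))
    ≡ 𝟙 (z ≡ᵇ suc j) + (𝟙 ((cA ∧ cB) ∧ (z ≡ᵇ suc j)) + 𝟙 ((cA ∧ cB) ∧ (z ≡ᵇ j)))
  k-face-inclusion-exclusion {k} {j} k+j≡d S = trans
    (cong (λ c → 𝟙 (isFace d a m S ∧ c) + (𝟙 (cA ∧ (z ≡ᵇ suc j)) + 𝟙 (cB ∧ (z ≡ᵇ suc j))))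
          (faceDim≡ᵇ-by-complement k+j≡d S))
    (𝟙-inclusion-exclusion cA cB (z ≡ᵇ j) (z ≡ᵇ suc j))
    where
    cA cB : Bool
    cA = covers d a m A S
    cB = covers d a m B S
    z : ℕ
    z = ∣ ∁ S ∣

fk-formula : ∀ {d a m k j} → m ≤ a → a ≤ d → 1 ≤ k → k + j ≡ d →
  fk d a m k + ((suc d ∸ m) choose suc j + (suc d ∸ (a ∸ m)) choose suc j)
    ≡ (2 + d) choose suc j + (suc d ∸ a) choose suc j
fk-formula {d} {a} {m} {suc k} {j} m≤a a≤d _ k+j≡d = begin
    fk d a m (suc k) + ((suc d ∸ m) choose suc j + (suc d ∸ (a ∸ m)) choose suc j)
  ≡⟨ cong₂ _+_ (length-filter≡sum face (allSubsets n)) (cong₂ _+_ (sym #A) (sym #B)) ⟩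
    ∑ n (𝟙 ∘ face) + (∑ n (λ S → 𝟙 (cA S ∧ e₁ S)) + ∑ n (λ S → 𝟙 (cB S ∧ e₁ S)))
  ≡⟨ sym (∑-+₃ n (𝟙 ∘ face) _ _) ⟩
    ∑ n (λ S → 𝟙 (face S) + (𝟙 (cA S ∧ e₁ S) + 𝟙 (cB S ∧ e₁ S)))
  ≡⟨ ∑-cong n (k-face-inclusion-exclusion d a m k+j≡d) ⟩
    ∑ n (λ S → 𝟙 (e₁ S) + (𝟙 (cAB S ∧ e₁ S) + 𝟙 (cAB S ∧ e₀ S)))
  ≡⟨ ∑-+₃ n (𝟙 ∘ e₁) _ _ ⟩
    ∑ n (𝟙 ∘ e₁) + (∑ n (λ S → 𝟙 (cAB S ∧ e₁ S)) + ∑ n (λ S → 𝟙 (cAB S ∧ e₀ S)))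
  ≡⟨ cong₂ _+_ #all (cong₂ _+_ (#A∪B (suc j)) (#A∪B j)) ⟩
    n choose suc j + ((d ∸ a) choose suc j + (d ∸ a) choose j)
  ≡⟨ cong (n choose suc j +_) (trans (+-comm ((d ∸ a) choose suc j) _) pascal) ⟩
    n choose suc j + (suc d ∸ a) choose suc j ∎
  where
  open ≡-Reasoning
  n = 2 + d
  face cA cB cAB e₀ e₁ : Subset n → Bool
  face S = isFace d a m S ∧ (0 <ᵇ ∣ S ∣) ∧ (faceDim d a m S ≡ᵇ suc k)
  cA S   = covers d a m A S
  cB S   = covers d a m B S
  cAB S  = cA S ∧ cB S
  e₀ S   = ∣ ∁ S ∣ ≡ᵇ j
  e₁ S   = ∣ ∁ S ∣ ≡ᵇ suc j
  a+2≤n : a + 2 ≤ n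
  a+2≤n = subst (a + 2 ≤_) (+-comm d 2) (+-monoˡ-≤ 2 a≤d)
  #A : ∑ n (λ S → 𝟙 (cA S ∧ e₁ S)) ≡ (suc d ∸ m) choose suc j
  #A = #supersets-of (interval n 0 (suc m)) (covers-A d a m)
         (∣interval∣ 0 (suc m) z≤n (s≤s (≤-trans m≤a (≤-trans a≤d (n≤1+n d))))) (suc j)
  #B : ∑ n (λ S → 𝟙 (cB S ∧ e₁ S)) ≡ (suc d ∸ (a ∸ m)) choose suc j
  #B = #supersets-of (interval n (suc m) (a + 2)) (covers-B d a m)
         (trans (∣interval∣ (suc m) (a + 2) (subst (suc m ≤_) (+-comm 2 a) (s≤s (m≤n⇒m≤1+n m≤a))) a+2≤n)
                (trans (cong (_∸ suc m) (+-comm a 2)) (+-∸-assoc 1 m≤a))) (suc j)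
  #A∪B : ∀ j′ → ∑ n (λ S → 𝟙 (cAB S ∧ (∣ ∁ S ∣ ≡ᵇ j′))) ≡ (d ∸ a) choose j′
  #A∪B = #supersets-of (interval n 0 (a + 2)) (covers-A∧B d a m m≤a)
           (trans (∣interval∣ 0 (a + 2) z≤n a+2≤n) (+-comm a 2))
  #all : ∑ n (𝟙 ∘ e₁) ≡ n choose suc j
  #all = #supersets-of {n} ⊥ (λ S → sym (⊥⊆ᵇ S)) (∣⊥∣≡0 n) (suc j)
  pascal : (d ∸ a) choose j + (d ∸ a) choose suc j ≡ (suc d ∸ a) choose suc j
  pascal = trans (nCk+nC[k+1]≡[n+1]C[k+1] (d ∸ a) j) (cong (_choose suc j) (sym (+-∸-assoc 1 a≤d)))

-- Binomial coefficients and discrete convexity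
mono-by-steps : ∀ (f : ℕ → ℕ) → (∀ n → f n ≤ f (suc n)) → ∀ {m n} → m ≤ n → f m ≤ f n
mono-by-steps f step m≤n = go (≤⇒≤′ m≤n)
  where
  go : ∀ {m n} → m ≤′ n → f m ≤ f n
  go ≤′-refl        = ≤-refl
  go (≤′-step m≤′n) = ≤-trans (go m≤′n) (step _)

antitone-by-steps : ∀ (f : ℕ → ℕ) → (∀ n → f (suc n) ≤ f n) → ∀ {m n} → m ≤ n → f n ≤ f m
antitone-by-steps f step m≤n = go (≤⇒≤′ m≤n)
  where
  go : ∀ {m n} → m ≤′ n → f n ≤ f m
  go ≤′-refl        = ≤-refl
  go (≤′-step m≤′n) = ≤-trans (step _) (go m≤′n)

k≤n⇒nCk>0 : ∀ {n k} → k ≤ n → 0 < n choose k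
k≤n⇒nCk>0 {n}     {zero}  _         = s≤s z≤n
k≤n⇒nCk>0 {suc n} {suc k} (s≤s k≤n) =
  subst (0 <_) (nCk+nC[k+1]≡[n+1]C[k+1] n k) (<-≤-trans (k≤n⇒nCk>0 k≤n) (m≤m+n _ _))

nCk≤[1+n]Ck : ∀ n k → n choose k ≤ suc n choose k
nCk≤[1+n]Ck n zero    = ≤-refl
nCk≤[1+n]Ck n (suc k) = subst (n choose suc k ≤_) (nCk+nC[k+1]≡[n+1]C[k+1] n k) (m≤n+m _ _)

nC[1+k]<[1+n]C[1+k] : ∀ {n k} → k ≤ n → n choose suc k < suc n choose suc k
nC[1+k]<[1+n]C[1+k] {n} {k} k≤n =
  subst (n choose suc k <_) (nCk+nC[k+1]≡[n+1]C[k+1] n k) (m<n+m _ (k≤n⇒nCk>0 k≤n))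

choose-monoˡ-≤ : ∀ k {m n} → m ≤ n → m choose k ≤ n choose k
choose-monoˡ-≤ k = mono-by-steps (_choose k) (λ n → nCk≤[1+n]Ck n k)

[n∸1+t]C[1+k]<[n∸t]C[1+k] : ∀ n t {k} → t + suc k ≤ n → (n ∸ suc t) choose suc k < (n ∸ t) choose suc k
[n∸1+t]C[1+k]<[n∸t]C[1+k] (suc n) zero    (s≤s k≤n) = nC[1+k]<[1+n]C[1+k] k≤n
[n∸1+t]C[1+k]<[n∸t]C[1+k] (suc n) (suc t) (s≤s t+k<n) = [n∸1+t]C[1+k]<[n∸t]C[1+k] n t t+k<n

pascal-∸ : ∀ n t k →
  (suc n ∸ t) choose suc (suc k) ≡ (n ∸ t) choose suc (suc k) + (n ∸ t) choose suc k
pascal-∸ n       zero    k =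
  trans (sym (nCk+nC[k+1]≡[n+1]C[k+1] n (suc k))) (+-comm (n choose suc k) _)
pascal-∸ zero    (suc t) k rewrite 0∸n≡0 t = refl
pascal-∸ (suc n) (suc t) k = pascal-∸ n t k

module Differences (h δ : ℕ → ℕ) (h-step : ∀ t → h t ≡ h (suc t) + δ t) where

  exchange-< : ∀ {x y} → δ y < δ x → h y + h (suc x) < h x + h (suc y)
  exchange-< {x} {y} δy<δx = begin-strict
    h y + h (suc x)               ≡⟨ cong (_+ h (suc x)) (h-step y) ⟩
    h (suc y) + δ y + h (suc x)   ≡⟨ xy∙z≈y∙xz (h (suc y)) (δ y) (h (suc x)) ⟩
    δ y + (h (suc y) + h (suc x)) <⟨ +-monoˡ-< _ δy<δx ⟩
    δ x + (h (suc y) + h (suc x)) ≡⟨ x∙yz≈zx∙y (δ x) (h (suc y)) (h (suc x)) ⟩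
    h (suc x) + δ x + h (suc y)   ≡⟨ cong (_+ h (suc y)) (sym (h-step x)) ⟩
    h x + h (suc y)               ∎
    where open ≤-Reasoning

  split-bound-base : ∀ b → h 1 + h b ≡ h 1 + δ (1 * b) + h (1 + b)
  split-bound-base b = begin
    h 1 + h b                 ≡⟨ cong (h 1 +_) (h-step b) ⟩
    h 1 + (h (suc b) + δ b)   ≡⟨ x∙yz≈xz∙y (h 1) (h (suc b)) (δ b) ⟩
    h 1 + δ b + h (suc b)     ≡⟨ cong (λ u → h 1 + δ u + h (suc b)) (sym (*-identityˡ b)) ⟩
    h 1 + δ (1 * b) + h (1 + b) ∎
    where open ≡-Reasoning

  split-bound-step : ∀ b M s t →
    s + (h M + h b) ≤ h 1 + δ (M * b) + h (M + b) →
    t + (δ (M * b) + δ (M + b)) ≤ δ M + δ (M * b + b) →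
    s + t + (h (suc M) + h b) ≤ h 1 + δ (suc M * b) + h (suc M + b)
  split-bound-step b M s t bound convex = +-cancelʳ-≤ (δ M) _ _ (begin
    s + t + (h (suc M) + h b) + δ M               ≡⟨ rearrange₁ s t (h (suc M)) (h b) (δ M) ⟩
    t + (s + (h (suc M) + δ M + h b))             ≡⟨ cong (λ u → t + (s + (u + h b))) (sym (h-step M)) ⟩
    t + (s + (h M + h b))                         ≤⟨ +-monoʳ-≤ t bound ⟩
    t + (h 1 + δ (M * b) + h (M + b))             ≡⟨ cong (λ u → t + (h 1 + δ (M * b) + u)) (h-step (M + b)) ⟩
    t + (h 1 + δ (M * b) + (h (suc M + b) + δ (M + b)))
                                                  ≡⟨ rearrange₂ t (h 1) (δ (M * b)) (h (suc M + b)) (δ (M + b)) ⟩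
    h 1 + h (suc M + b) + (t + (δ (M * b) + δ (M + b)))
                                                  ≤⟨ +-monoʳ-≤ (h 1 + h (suc M + b)) convex ⟩
    h 1 + h (suc M + b) + (δ M + δ (M * b + b))   ≡⟨ cong (λ u → h 1 + h (suc M + b) + (δ M + δ u)) (+-comm (M * b) b) ⟩
    h 1 + h (suc M + b) + (δ M + δ (suc M * b))   ≡⟨ rearrange₃ (h 1) (h (suc M + b)) (δ M) (δ (suc M * b)) ⟩
    h 1 + δ (suc M * b) + h (suc M + b) + δ M     ∎)
    where
    open ≤-Reasoning
    rearrange₁ : ∀ s t x y z → s + t + (x + y) + z ≡ t + (s + (x + z + y))
    rearrange₁ = solve-∀
    rearrange₂ : ∀ t x y z w → t + (x + y + (z + w)) ≡ x + z + (t + (y + w))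
    rearrange₂ = solve-∀
    rearrange₃ : ∀ x y z w → x + y + (z + w) ≡ x + w + y + z
    rearrange₃ = solve-∀

  module Convex (ε : ℕ → ℕ) (δ-step : ∀ t → δ t ≡ δ (suc t) + ε t)
                (ε-step : ∀ t → ε (suc t) ≤ ε t) where

    δ-antitone : ∀ {x y} → x ≤ y → δ y ≤ δ x
    δ-antitone = antitone-by-steps δ (λ t → subst (δ (suc t) ≤_) (sym (δ-step t)) (m≤m+n _ _))

    ε-antitone : ∀ {x y} → x ≤ y → ε y ≤ ε x
    ε-antitone = antitone-by-steps ε ε-step

    δ-step-+ : ∀ x c → δ (x + c) ≡ δ (x + suc c) + ε (x + c)
    δ-step-+ x c = trans (δ-step (x + c)) (cong (λ u → δ u + ε (x + c)) (sym (+-suc x c)))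

    δ-convex : ∀ c {x y} → x ≤ y → δ y + δ (x + c) ≤ δ x + δ (y + c)
    δ-convex zero {x} {y} _ rewrite +-identityʳ x | +-identityʳ y = ≤-reflexive (+-comm (δ y) (δ x))
    δ-convex (suc c) {x} {y} x≤y = +-cancelʳ-≤ (ε (x + c)) _ _ (begin
      δ y + δ (x + suc c) + ε (x + c)         ≡⟨ +-assoc (δ y) _ _ ⟩
      δ y + (δ (x + suc c) + ε (x + c))       ≡⟨ cong (δ y +_) (sym (δ-step-+ x c)) ⟩
      δ y + δ (x + c)                         ≤⟨ δ-convex c x≤y ⟩
      δ x + δ (y + c)                         ≡⟨ cong (δ x +_) (δ-step-+ y c) ⟩
      δ x + (δ (y + suc c) + ε (y + c))       ≤⟨ +-monoʳ-≤ (δ x) (+-monoʳ-≤ _ (ε-antitone (+-monoˡ-≤ c x≤y))) ⟩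
      δ x + (δ (y + suc c) + ε (x + c))       ≡⟨ +-assoc (δ x) _ _ ⟨
      δ x + δ (y + suc c) + ε (x + c)         ∎)
      where open ≤-Reasoning

    δ-strictly-convex : ∀ c {x y} → x ≤ y → ε y < ε x → δ y + δ (x + suc c) < δ x + δ (y + suc c)
    δ-strictly-convex c {x} {y} x≤y εy<εx = begin-strict
      δ y + δ (x + suc c)                     ≡⟨ cong₂ _+_ (δ-step y) (cong δ (+-suc x c)) ⟩
      δ (suc y) + ε y + δ (suc x + c)         ≡⟨ xy∙z≈y∙xz (δ (suc y)) (ε y) _ ⟩
      ε y + (δ (suc y) + δ (suc x + c))       <⟨ +-mono-<-≤ εy<εx (δ-convex c (s≤s x≤y)) ⟩
      ε x + (δ (suc x) + δ (suc y + c))       ≡⟨ xy∙z≈y∙xz (δ (suc x)) (ε x) _ ⟨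
      δ (suc x) + ε x + δ (suc y + c)         ≡⟨ cong₂ _+_ (δ-step x) (cong δ (+-suc y c)) ⟨
      δ x + δ (y + suc c)                     ∎
      where open ≤-Reasoning

    split-bound-strict : ∀ M b → 2 ≤ b → ε 2 < ε 1 →
      h (2 + M) + h b < h 1 + δ ((2 + M) * b) + h (2 + M + b)
    split-bound-strict zero b@(suc c) 2≤b ε₂<ε₁ =
      split-bound-step b 1 0 1 (≤-reflexive (split-bound-base b))
        (δ-strictly-convex c (s≤s z≤n) (≤-<-trans (ε-antitone (subst (2 ≤_) (sym (*-identityˡ b)) 2≤b)) ε₂<ε₁))
    split-bound-strict (suc M) b@(suc _) 2≤b ε₂<ε₁ =
      split-bound-step b (2 + M) 1 0 (split-bound-strict M b 2≤b ε₂<ε₁) (δ-convex b (m≤m*n (2 + M) b))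

split-quadratic : ∀ (h : ℕ → ℕ) c → (∀ t → h t ≡ h (suc t) + (c ∸ t)) →
                  ∀ m b → m + b ≤ c → h m + h b + m * b ≡ h 0 + h (m + b)
split-quadratic h c h-step zero    b _       = +-identityʳ (h 0 + h b)
split-quadratic h c h-step (suc m) b m+b<c = +-cancelʳ-≡ (c ∸ (m + b)) _ _ (begin
    h (suc m) + h b + (b + m * b) + (c ∸ (m + b))   ≡⟨ rearrange (h (suc m)) (h b) b (m * b) (c ∸ (m + b)) ⟩
    h (suc m) + (c ∸ (m + b) + b) + h b + m * b     ≡⟨ cong (λ u → h (suc m) + u + h b + m * b) c∸m≡ ⟩
    h (suc m) + (c ∸ m) + h b + m * b               ≡⟨ cong (λ u → u + h b + m * b) (h-step m) ⟨
    h m + h b + m * b                               ≡⟨ split-quadratic h c h-step m b (<⇒≤ m+b<c) ⟩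
    h 0 + h (m + b)                                 ≡⟨ cong (h 0 +_) (h-step (m + b)) ⟩
    h 0 + (h (suc m + b) + (c ∸ (m + b)))           ≡⟨ +-assoc (h 0) _ _ ⟨
    h 0 + h (suc m + b) + (c ∸ (m + b))             ∎)
  where
  open ≡-Reasoning
  rearrange : ∀ x y u v w → x + y + (u + v) + w ≡ x + (w + u) + y + v
  rearrange = solve-∀
  c∸m≡ : c ∸ (m + b) + b ≡ c ∸ m
  c∸m≡ = trans (cong (_+ b) (sym (∸-+-assoc c m b)))
               (m∸n+n≡m (m+n≤o⇒m≤o∸n b (subst (_≤ c) (+-comm m b) (<⇒≤ m+b<c))))

fk-facets : ∀ {d a m} → m ≤ a → a ≤ d → 2 ≤ d → fk d a m (d ∸ 1) ≡ suc d + m * (a ∸ m)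
fk-facets {d@(suc (suc _))} {a} {m} m≤a a≤d (s≤s (s≤s z≤n)) = +-cancelʳ-≡ (H m + H b) _ _ (begin
    fk d a m (d ∸ 1) + (H m + H b)            ≡⟨ fk-formula m≤a a≤d (s≤s z≤n) (+-comm (d ∸ 1) 1) ⟩
    (2 + d) choose 2 + H a                    ≡⟨ cong₂ _+_ (sym (nCk+nC[k+1]≡[n+1]C[k+1] (suc d) 1)) (cong H (sym m+b≡a)) ⟩
    suc d choose 1 + H 0 + H (m + b)          ≡⟨ cong (λ u → u + H 0 + H (m + b)) (nC1≡n (suc d)) ⟩
    suc d + H 0 + H (m + b)                   ≡⟨ +-assoc (suc d) _ _ ⟩
    suc d + (H 0 + H (m + b))                 ≡⟨ cong (suc d +_) (split-quadratic H d H-step m b (subst (_≤ d) (sym m+b≡a) a≤d)) ⟨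
    suc d + (H m + H b + m * b)               ≡⟨ rearrange (suc d) (H m) (H b) (m * b) ⟩
    suc d + m * b + (H m + H b)               ∎)
  where
  open ≡-Reasoning
  b = a ∸ m
  m+b≡a : m + b ≡ a
  m+b≡a = m+[n∸m]≡n m≤a
  H : ℕ → ℕ
  H t = (suc d ∸ t) choose 2
  H-step : ∀ t → H t ≡ H (suc t) + (d ∸ t)
  H-step t = trans (pascal-∸ d t 0) (cong (H (suc t) +_) (nC1≡n (d ∸ t)))
  rearrange : ∀ s x y z → s + (x + y + z) ≡ s + z + (x + y)
  rearrange = solve-∀

CombEquiv-refl : ∀ d a m → CombEquiv d a m a m
CombEquiv-refl d a m = ↔-id _ , λ S → cong (isFace d a m) (sym (tabulate∘lookup S))

inequivalent⇒suc< : ∀ {d ℓ a} → 1 ≤ a → ℓ ≤ a ∸ 1 → ¬ CombEquiv d a 1 (suc ℓ) 1 → suc ℓ < a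
inequivalent⇒suc< {d} {ℓ} {suc b} _ ℓ≤b inequivalent with m≤n⇒m<n∨m≡n ℓ≤b
... | inj₁ ℓ<b  = s≤s ℓ<b
... | inj₂ refl = ⊥-elim (inequivalent (CombEquiv-refl d (suc ℓ) 1))

fk-T₁-increasing : ∀ {d ℓ a k} → suc ℓ < a → a ≤ d → 1 ≤ k → ℓ ≤ k → k + 1 ≤ d →
                   fk d (suc ℓ) 1 k < fk d a 1 k
fk-T₁-increasing {d} {ℓ} {suc b} {k} (s≤s ℓ<b) a≤d 1≤k ℓ≤k k+1≤d
  with i , k+j≡d ← ≤⇒offset 1 k+1≤d =
  <-by-offsets (fk-formula (s≤s z≤n) (≤-trans (m≤n⇒m≤1+n ℓ<b) a≤d) 1≤k k+j≡d)
               (fk-formula (s≤s z≤n) a≤d 1≤k k+j≡d)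
               (begin-strict
                 H 1 + H b + H (suc ℓ)     ≡⟨ +-assoc (H 1) _ _ ⟩
                 H 1 + (H b + H (suc ℓ))   <⟨ +-monoʳ-< (H 1) (exchange-< {ℓ} {b} δb<δℓ) ⟩
                 H 1 + (H ℓ + H (suc b))   ≡⟨ +-assoc (H 1) _ _ ⟨
                 H 1 + H ℓ + H (suc b)     ∎)
  where
  open ≤-Reasoning
  H δ : ℕ → ℕ
  H t = (suc d ∸ t) choose suc (suc i)
  δ t = (d ∸ t) choose suc i
  open Differences H δ (λ t → pascal-∸ d t i)
  δb<δℓ : δ b < δ ℓ
  δb<δℓ = ≤-<-trans (choose-monoˡ-≤ (suc i) (∸-monoʳ-≤ d ℓ<b))
            ([n∸1+t]C[1+k]<[n∸t]C[1+k] d ℓ (subst (ℓ + suc i ≤_) k+j≡d (+-monoˡ-≤ (suc i) ℓ≤k)))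

fk-T₁<fk-Tₘ : ∀ {d ℓ a m k} → 2 ≤ m → m + m ≤ a → a ≤ d → suc ℓ ≤ d → ℓ ≤ m * (a ∸ m) →
              1 ≤ k → k + 2 ≤ d → fk d (suc ℓ) 1 k < fk d a m k
fk-T₁<fk-Tₘ {ℓ = ℓ} {a} (s≤s (s≤s (z≤n {M}))) 2m≤a a≤d ℓ<d@(s≤s {n = d₁} _) ℓ≤mb 1≤k@(s≤s {n = k₁} z≤n) k+2≤d
  with i , k+j≡d ← ≤⇒offset {suc k₁} 2 k+2≤d =
  <-by-offsets (fk-formula (s≤s z≤n) ℓ<d 1≤k k+j≡d) (fk-formula m≤a a≤d 1≤k k+j≡d) (begin-strict
    H m + H b + H (suc ℓ)                     <⟨ +-monoˡ-< (H (suc ℓ)) (split-bound-strict M b 2≤b ε₂<ε₁) ⟩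
    H 1 + δ (m * b) + H (m + b) + H (suc ℓ)   ≤⟨ +-monoˡ-≤ (H (suc ℓ)) (+-monoˡ-≤ (H (m + b)) (+-monoʳ-≤ (H 1) (δ-antitone ℓ≤mb))) ⟩
    H 1 + δ ℓ + H (m + b) + H (suc ℓ)         ≡⟨ rearrange (H 1) (δ ℓ) (H (m + b)) (H (suc ℓ)) ⟩
    H 1 + (H (suc ℓ) + δ ℓ) + H (m + b)       ≡⟨ cong₂ (λ u v → H 1 + u + H v) (sym (h-step ℓ)) m+b≡a ⟩
    H 1 + H ℓ + H a                           ∎)
  where
  open ≤-Reasoning
  m b : ℕ
  m = suc (suc M)
  b = a ∸ m
  m≤a : m ≤ a
  m≤a = ≤-trans (m≤m+n m m) 2m≤a
  m+b≡a : m + b ≡ a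
  m+b≡a = m+[n∸m]≡n m≤a
  2≤b : 2 ≤ b
  2≤b = ≤-trans (s≤s (s≤s z≤n)) (m+n≤o⇒m≤o∸n m 2m≤a)
  H δ ε : ℕ → ℕ
  H t = (suc (suc d₁) ∸ t) choose suc (suc (suc i))
  δ t = (suc d₁ ∸ t) choose suc (suc i)
  ε t = (d₁ ∸ t) choose suc i
  h-step : ∀ t → H t ≡ H (suc t) + δ t
  h-step t = pascal-∸ (suc d₁) t (suc i)
  open Differences H δ h-step
  open Convex ε (λ t → pascal-∸ d₁ t i)
              (λ t → choose-monoˡ-≤ (suc i) (∸-monoʳ-≤ d₁ (n≤1+n t)))
  ε₂<ε₁ : ε 2 < ε 1
  ε₂<ε₁ = [n∸1+t]C[1+k]<[n∸t]C[1+k] d₁ 1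
            (subst (suc (suc i) ≤_) (suc-injective k+j≡d) (m≤n+m (suc (suc i)) k₁))
  rearrange : ∀ x y z w → x + y + z + w ≡ x + (w + y) + z
  rearrange = solve-∀

theorem3p2 : (d ℓ a m : ℕ) → 3 ≤ d → 2 ≤ ℓ → ℓ ≤ d → 2 ≤ a → a ≤ d → 1 ≤ m → m ≤ ⌊ a /2⌋ →
    d + ℓ ≤ fk d a m (d ∸ 1) →
    ¬ CombEquiv d a m ℓ 1 →
    (m ≡ 1 → (k : ℕ) → ℓ ∸ 1 ≤ k → k ≤ d ∸ 1 → fk d ℓ 1 k < fk d a m k)
    × (2 ≤ m → (k : ℕ) → 1 ≤ k → k ≤ d ∸ 2 → fk d ℓ 1 k < fk d a m k)
theorem3p2 d (suc ℓ) a m 3≤d (s≤s 1≤ℓ) ℓ<d 2≤a a≤d _ m≤a/2 enough-facets inequivalent =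
    (λ { refl k ℓ≤k k≤d∸1 →
           fk-T₁-increasing (inequivalent⇒suc< 1≤a (subst (ℓ ≤_) (*-identityˡ (a ∸ 1)) ℓ≤mb) inequivalent)
             a≤d (≤-trans 1≤ℓ ℓ≤k) ℓ≤k (m≤o∸n⇒m+n≤o k (≤-trans (s≤s z≤n) 3≤d) k≤d∸1) })
  , (λ 2≤m k 1≤k k≤d∸2 →
           fk-T₁<fk-Tₘ 2≤m 2m≤a a≤d ℓ<d ℓ≤mb 1≤k (m≤o∸n⇒m+n≤o k (≤-trans (n≤1+n 2) 3≤d) k≤d∸2))
  where
  1≤a : 1 ≤ a
  1≤a = ≤-trans (n≤1+n 1) 2≤a
  2m≤a : m + m ≤ a
  2m≤a = m≤⌊n/2⌋⇒m+m≤n m≤a/2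
  ℓ≤mb : ℓ ≤ m * (a ∸ m)
  ℓ≤mb = +-cancelˡ-≤ d ℓ (m * (a ∸ m)) (≤-pred (subst₂ _≤_ (+-suc d ℓ)
           (fk-facets (≤-trans (m≤m+n m m) 2m≤a) a≤d (≤-trans (n≤1+n 2) 3≤d)) enough-facets))
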